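{- $X\in\{0,1\}^\omega$ is Martin-Löf $\mathrm{BP}$ random if and only if $X$ passes every weak primitive recursive test, i.e. for every weak primitive recursive test $(U_n)_{n\ge0}$ there is $n$ with $X\notin U_n$.
   Context: For a finite string $\sigma$, $[\sigma]=\{Y\in\{0,1\}^\omega:\sigma\sqsubset Y\}$, and $[G]=\bigcup_{\sigma\in G}[\sigma]$. $\mu$ is the uniform measure on $\{0,1\}^\omega$. Strings and finite sets of strings are coded by natural numbers in a standard primitive recursive way. A primitive recursive test is a sequence of clopen sets $U_n=[G_n]$, where $G_n$ is a finite set of strings coded by $g(n)$ for a primitive recursive $g$, and $\mu(U_n)\le 2^{ -n}$ for all $n$. $X$ is Martin-Löf $\mathrm{BP}$ random if for every primitive recursive test there is $n$ with $X\notin U_n$. A weak primitive recursive test is a primitive recursive test $(U_n)$ for which there are a primitive recursive sequence $(G_n)$ of finite sets of strings and a primitive recursive function $\ell$ such that, for each $n$: - $U_n=[G_n]$; - every $\tau\in G_n$ has $|\tau|=\ell(n)$; - every $\tau\in G_n$ satisfies $\mu(U_{n+1}\cap[\tau])\le\frac12\mu([\tau])$. -}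

module Defs where

open import Data.Nat using (ℕ; zero; suc; _+_; _*_; _^_; _≤_; _⊔_; _%_; _/_; _≡ᵇ_)
open import Data.Bool using (Bool; true; false; _∧_; if_then_else_)
open import Data.List using (List; []; _∷_; map; length; reverse; filterᵇ; foldr)
open import Data.Bool.ListAction using (any)
open import Data.List.Relation.Unary.Any using (Any)
import Data.List.Relation.Unary.All
import Data.List
open import Data.Fin using (Fin)
open import Data.Vec using (Vec; []; _∷_; lookup)
open import Data.Product using (_×_; Σ)
open import Data.Unit using (⊤)
open import Relation.Binary.PropositionalEquality using (_≡_)
open import Relation.Nullary using (¬_)
open import Function.Bundles using (_⇔_)

data PR : ℕ → Set where
  zeroF : ∀ {k} → PR k
  succF : PR 1
  projF : ∀ {k} → Fin k → PR k
  compF : ∀ {k m} → PR m → Vec (PR k) m → PR k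
  recF  : ∀ {k} → PR k → PR (suc (suc k)) → PR (suc k)

mutual
  eval : ∀ {k} → PR k → Vec ℕ k → ℕ
  eval zeroF xs = 0
  eval succF (x ∷ []) = suc x
  eval (projF i) xs = lookup xs i
  eval (compF f gs) xs = eval f (evalVec gs xs)
  eval (recF f g) (n ∷ xs) = evalRec f g n xs

  evalVec : ∀ {k m} → Vec (PR k) m → Vec ℕ k → Vec ℕ m
  evalVec [] xs = []
  evalVec (g ∷ gs) xs = eval g xs ∷ evalVec gs xs

  evalRec : ∀ {k} → PR k → PR (suc (suc k)) → ℕ → Vec ℕ k → ℕ
  evalRec f g zero xs = eval f xs
  evalRec f g (suc n) xs = eval g (evalRec f g n xs ∷ n ∷ xs)

⟦_⟧ : PR 1 → ℕ → ℕ
⟦ f ⟧ n = eval f (n ∷ [])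

Str : Set
Str = List Bool

Seq : Set
Seq = ℕ → Bool

_⊏_ : Str → Seq → Set
[] ⊏ Y = ⊤
(b ∷ σ) ⊏ Y = (b ≡ Y 0) × (σ ⊏ (λ i → Y (suc i)))

_∈⟦_⟧ : Seq → List Str → Set
Y ∈⟦ G ⟧ = Any (λ σ → σ ⊏ Y) G

_⊑ᵇ_ : Str → Str → Bool
[] ⊑ᵇ τ = true
(b ∷ σ) ⊑ᵇ [] = false
(true ∷ σ) ⊑ᵇ (true ∷ τ) = σ ⊑ᵇ τ
(false ∷ σ) ⊑ᵇ (false ∷ τ) = σ ⊑ᵇ τ
(true ∷ σ) ⊑ᵇ (false ∷ τ) = false
(false ∷ σ) ⊑ᵇ (true ∷ τ) = false

allStr : ℕ → List Str
allStr zero = [] ∷ []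
allStr (suc L) = map (true ∷_) (allStr L) Data.List.++ map (false ∷_) (allStr L)

inGᵇ : List Str → Str → Bool
inGᵇ G ρ = any (λ σ → σ ⊑ᵇ ρ) G

maxLen : List Str → ℕ
maxLen G = foldr (λ σ m → length σ ⊔ m) 0 G

record Dyadic : Set where
  constructor _/2^_
  field
    num : ℕ
    exp : ℕ

_≤ᵈ_ : Dyadic → Dyadic → Set
(a /2^ e) ≤ᵈ (b /2^ f) = a * 2 ^ f ≤ b * 2 ^ e

-- measure of the clopen set determined by the first L bits via P:
-- #{ρ ∈ {0,1}^L : P ρ} / 2^L
μAt : ℕ → (Str → Bool) → Dyadic
μAt L P = length (filterᵇ P (allStr L)) /2^ L

μ⟦_⟧ : List Str → Dyadic
μ⟦ G ⟧ = μAt (maxLen G) (inGᵇ G)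

μ⟦_⟧∩⟦_⟧ : List Str → Str → Dyadic
μ⟦ G ⟧∩⟦ τ ⟧ = μAt (maxLen G ⊔ length τ) (λ ρ → inGᵇ G ρ ∧ (τ ⊑ᵇ ρ))

μcyl : Str → Dyadic
μcyl τ = 1 /2^ length τ

-- binary digits of m, least significant first (fuel-bounded)
digits : ℕ → ℕ → List Bool
digits zero m = []
digits (suc f) zero = []
digits (suc f) m@(suc _) = (m % 2 ≡ᵇ 1) ∷ digits f (m / 2)

dropLast : List Bool → List Bool
dropLast [] = []
dropLast (b ∷ []) = []
dropLast (b ∷ c ∷ bs) = b ∷ dropLast (c ∷ bs)

-- string coded by c: the binary expansion of c+1 with its leading 1 removed
decodeStr : ℕ → Str
decodeStr c = reverse (dropLast (digits (suc c) (suc c)))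

ones : ℕ → List Bool → List ℕ
ones k [] = []
ones k (true ∷ bs) = k ∷ ones (suc k) bs
ones k (false ∷ bs) = ones (suc k) bs

-- finite set coded by n (canonical index): { decodeStr i : bit i of n is 1 }
decodeSet : ℕ → List Str
decodeSet n = map decodeStr (ones 0 (digits n n))

U : PR 1 → ℕ → List Str
U g n = decodeSet (⟦ g ⟧ n)

IsPRTest : PR 1 → Set
IsPRTest g = ∀ n → μ⟦ U g n ⟧ ≤ᵈ (1 /2^ n)

IsWeakPRTest : PR 1 → Set
IsWeakPRTest g =
  IsPRTest g ×
  Σ (PR 1) λ h → Σ (PR 1) λ ℓ → ∀ n →
      (∀ X → (X ∈⟦ U g n ⟧) ⇔ (X ∈⟦ decodeSet (⟦ h ⟧ n) ⟧))
    × Data.List.Relation.Unary.All.All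
        (λ τ → (length τ ≡ ⟦ ℓ ⟧ n)
             × ((μ⟦ U g (suc n) ⟧∩⟦ τ ⟧) ≤ᵈ (1 /2^ suc (length τ))))
        (decodeSet (⟦ h ⟧ n))

Passes : Seq → PR 1 → Set
Passes X g = ¬ (∀ n → X ∈⟦ U g n ⟧)

MLBPRandom : Seq → Set
MLBPRandom X = ∀ g → IsPRTest g → Passes X g

-- Given a primitive recursive test (U n) whose generating sets have canonical indices g n, thin it
-- to V n = U (m n), where m 0 = 0 and m (n + 1) = g (m n) + m n + 1. With c = g (m n), every
-- string in the set with index c is shorter than c, so V n is also generated by the set of all
-- strings of length c extending one of them, and the index of this padded set is a primitive
-- recursive function of c. For τ of length c,
--   μ (V (n + 1) ∩ [τ]) ≤ μ (U (m (n + 1))) ≤ 2^-m(n+1) ≤ 2^-(c+1) = μ [τ] / 2,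
-- so (V n) is a weak test, and every X in ⋂ U n lies in ⋂ V n. Conversely, every weak test is a test.
module Submission where

open import Defs
open import Data.Bool using (Bool; true; false; T; _∧_; _∨_)
open import Data.Fin using (Fin; zero; suc)
open import Data.List using (List; []; _∷_; _++_; [_]; map; foldl; reverse; length; applyUpTo; filterᵇ)
open import Data.List.Properties
  using (filter-++; foldl-++; ++-assoc; ++-identityʳ; unfold-reverse; length-++; length-applyUpTo)
open import Data.List.Membership.Propositional using (_∈_; find; lose)
open import Data.List.Relation.Unary.Any using (here; there)
import Data.List.Relation.Unary.Any.Properties as Any
open import Data.List.Relation.Unary.All as All using (All)
import Data.List.Relation.Unary.All.Properties as All
open import Data.Nat
  using (ℕ; zero; suc; _+_; _*_; _∸_; _^_; _⊔_; _≤_; _<_; z≤n; s≤s; s≤s⁻¹; _≤?_; _<?_; pred; _%_; _/_; _≡ᵇ_; >-nonZero)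
open import Data.Nat.Properties
open import Data.Nat.DivMod
open import Data.Nat.Divisibility using (n∣m*n)
open import Data.Nat.Induction using (<-rec)
open import Data.Nat.Tactic.RingSolver using (solve-∀)
open import Data.Product using (∃-syntax; _×_; _,_; proj₁; proj₂)
open import Data.Sum using (inj₁; inj₂)
open import Data.Unit using (tt)
open import Data.Vec using (Vec; []; _∷_; head; tail; lookup; tabulate)
open import Data.Vec.Properties using (tabulate∘lookup)
open import Function using (_∘_)
open import Function.Bundles using (_⇔_; mk⇔)
open import Relation.Binary.PropositionalEquality hiding ([_])
open import Relation.Nullary using (contradiction; yes; no)
open import Relation.Nullary.Decidable using (T?)

-- Primitive recursive functions together with their meaning

record IsPrimRec {k} (f : Vec ℕ k → ℕ) : Set where
  field
    code  : PR k
    sound : ∀ xs → eval code xs ≡ f xs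

open IsPrimRec

IsPrimRec₁ : (ℕ → ℕ) → Set
IsPrimRec₁ f = IsPrimRec {1} (λ xs → f (head xs))

IsPrimRec₂ : (ℕ → ℕ → ℕ) → Set
IsPrimRec₂ f = IsPrimRec {2} (λ xs → f (head xs) (head (tail xs)))

castᴾ : ∀ {k} {f g : Vec ℕ k → ℕ} → (∀ xs → f xs ≡ g xs) → IsPrimRec f → IsPrimRec g
castᴾ f≗g F = record { code = code F ; sound = λ xs → trans (sound F xs) (f≗g xs) }

zeroᴾ : ∀ {k} → IsPrimRec {k} (λ _ → 0)
zeroᴾ = record { code = zeroF ; sound = λ _ → refl }

succᴾ : IsPrimRec₁ suc
succᴾ = record { code = succF ; sound = λ { (x ∷ []) → refl } }

projᴾ : ∀ {k} (i : Fin k) → IsPrimRec (λ xs → lookup xs i)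
projᴾ i = record { code = projF i ; sound = λ _ → refl }

comp₁ : ∀ {k} {f : Vec ℕ 1 → ℕ} {g : Vec ℕ k → ℕ} →
        IsPrimRec f → IsPrimRec g → IsPrimRec (λ xs → f (g xs ∷ []))
comp₁ {f = f} F G = record
  { code  = compF (code F) (code G ∷ [])
  ; sound = λ xs → trans (sound F _) (cong (λ a → f (a ∷ [])) (sound G xs))
  }

comp₂ : ∀ {k} {f : Vec ℕ 2 → ℕ} {g h : Vec ℕ k → ℕ} →
        IsPrimRec f → IsPrimRec g → IsPrimRec h → IsPrimRec (λ xs → f (g xs ∷ h xs ∷ []))
comp₂ {f = f} F G H = record
  { code  = compF (code F) (code G ∷ code H ∷ [])
  ; sound = λ xs → trans (sound F _) (cong₂ (λ a b → f (a ∷ b ∷ [])) (sound G xs) (sound H xs))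
  }

recᴾ : ∀ {k} {f : Vec ℕ k → ℕ} {g : Vec ℕ (suc (suc k)) → ℕ} →
       IsPrimRec f → IsPrimRec g → (r : Vec ℕ (suc k) → ℕ) →
       (∀ xs → r (0 ∷ xs) ≡ f xs) → (∀ n xs → r (suc n ∷ xs) ≡ g (r (n ∷ xs) ∷ n ∷ xs)) →
       IsPrimRec r
recᴾ {g = g} F G r r-zero r-suc = record
  { code  = recF (code F) (code G)
  ; sound = λ { (n ∷ xs) → evalRec-sound n xs }
  }
  where
  evalRec-sound : ∀ n xs → evalRec (code F) (code G) n xs ≡ r (n ∷ xs)
  evalRec-sound zero    xs = trans (sound F xs) (sym (r-zero xs))
  evalRec-sound (suc n) xs =
    trans (sound G _) (trans (cong (λ a → g (a ∷ n ∷ xs)) (evalRec-sound n xs)) (sym (r-suc n xs)))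

evalVec-projs : ∀ {m n} (ρ : Fin m → Fin n) xs → evalVec (tabulate (projF ∘ ρ)) xs ≡ tabulate (lookup xs ∘ ρ)
evalVec-projs {zero}  ρ xs = refl
evalVec-projs {suc m} ρ xs = cong (lookup xs (ρ zero) ∷_) (evalVec-projs (ρ ∘ suc) xs)

weakenᴾ : ∀ {k} {f : Vec ℕ k → ℕ} → IsPrimRec f → IsPrimRec (f ∘ tail)
weakenᴾ F = record
  { code  = compF (code F) (tabulate (projF ∘ suc))
  ; sound = λ { (a ∷ xs) →
      trans (cong (eval (code F)) (trans (evalVec-projs suc (a ∷ xs)) (tabulate∘lookup xs))) (sound F xs) }
  }

oneᴾ : ∀ {k} → IsPrimRec {k} (λ _ → 1)
oneᴾ = comp₁ succᴾ zeroᴾ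

addᴾ : IsPrimRec₂ _+_
addᴾ = recᴾ (projᴾ zero) (comp₁ succᴾ (projᴾ zero)) _ (λ { (b ∷ []) → refl }) (λ { n (b ∷ []) → refl })

mulᴾ : IsPrimRec₂ _*_
mulᴾ = recᴾ zeroᴾ (comp₂ addᴾ (projᴾ (suc (suc zero))) (projᴾ zero)) _ (λ _ → refl) (λ { n (b ∷ []) → refl })

predᴾ : IsPrimRec₁ pred
predᴾ = recᴾ zeroᴾ (projᴾ (suc zero)) _ (λ { [] → refl }) (λ { n [] → refl })

monusᴾ : IsPrimRec₂ _∸_
monusᴾ = castᴾ (λ { (a ∷ b ∷ []) → refl }) (comp₂ flippedᴾ (projᴾ (suc zero)) (projᴾ zero))
  where
  flippedᴾ : IsPrimRec₂ (λ b a → a ∸ b)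
  flippedᴾ = recᴾ (projᴾ zero) (comp₁ predᴾ (projᴾ zero)) _ (λ { (a ∷ []) → refl })
                  (λ { n (a ∷ []) → sym (pred[m∸n]≡m∸[1+n] a n) })

pow2ᴾ : IsPrimRec₁ (2 ^_)
pow2ᴾ = recᴾ oneᴾ (comp₂ addᴾ (projᴾ zero) (projᴾ zero)) _ (λ { [] → refl })
             (λ { n [] → cong (2 ^ n +_) (+-identityʳ (2 ^ n)) })

[2+n]%2≡n%2 : ∀ n → (2 + n) % 2 ≡ n % 2
[2+n]%2≡n%2 n = trans (cong (_% 2) (+-comm 2 n)) ([m+n]%n≡m%n n 2)

[2+n]/2≡1+n/2 : ∀ n → (2 + n) / 2 ≡ suc (n / 2)
[2+n]/2≡1+n/2 n = m/n≡1+[m∸n]/n {2 + n} {2} (s≤s (s≤s z≤n))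

[1+n]%2≡1∸n%2 : ∀ n → suc n % 2 ≡ 1 ∸ n % 2
[1+n]%2≡1∸n%2 zero          = refl
[1+n]%2≡1∸n%2 (suc zero)    = refl
[1+n]%2≡1∸n%2 (suc (suc n)) =
  trans ([2+n]%2≡n%2 (suc n)) (trans ([1+n]%2≡1∸n%2 n) (cong (1 ∸_) (sym ([2+n]%2≡n%2 n))))

[1+n]/2≡n/2+n%2 : ∀ n → suc n / 2 ≡ n / 2 + n % 2
[1+n]/2≡n/2+n%2 zero          = refl
[1+n]/2≡n/2+n%2 (suc zero)    = refl
[1+n]/2≡n/2+n%2 (suc (suc n)) = begin
  (3 + n) / 2                ≡⟨ [2+n]/2≡1+n/2 (suc n) ⟩
  suc (suc n / 2)            ≡⟨ cong suc ([1+n]/2≡n/2+n%2 n) ⟩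
  suc (n / 2 + n % 2)        ≡⟨ cong₂ _+_ ([2+n]/2≡1+n/2 n) ([2+n]%2≡n%2 n) ⟨
  (2 + n) / 2 + (2 + n) % 2  ∎
  where open ≡-Reasoning

parityᴾ : IsPrimRec₁ (_% 2)
parityᴾ = recᴾ zeroᴾ (comp₂ monusᴾ oneᴾ (projᴾ zero)) _ (λ { [] → refl }) (λ { n [] → [1+n]%2≡1∸n%2 n })

halfᴾ : IsPrimRec₁ (_/ 2)
halfᴾ = recᴾ zeroᴾ (comp₂ addᴾ (projᴾ zero) (comp₁ parityᴾ (projᴾ (suc zero)))) _ (λ { [] → refl })
             (λ { n [] → [1+n]/2≡n/2+n%2 n })

infixl 8 _≫_

_≫_ : ℕ → ℕ → ℕ
x ≫ zero  = x
x ≫ suc k = x ≫ k / 2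

≫ᴾ : IsPrimRec₂ (λ k x → x ≫ k)
≫ᴾ = recᴾ (projᴾ zero) (comp₁ halfᴾ (projᴾ zero)) _ (λ { (x ∷ []) → refl }) (λ { k (x ∷ []) → refl })

∑< : ℕ → (ℕ → ℕ) → ℕ
∑< zero    f = 0
∑< (suc n) f = ∑< n f + f n

infix 5 ∑<
syntax ∑< n (λ i → e) = ∑[ i < n ] e

∑ᴾ : ∀ {k} {f : Vec ℕ (suc k) → ℕ} {b : Vec ℕ k → ℕ} →
     IsPrimRec f → IsPrimRec b → IsPrimRec (λ xs → ∑[ i < b xs ] f (i ∷ xs))
∑ᴾ {f = f} F B = record
  { code  = compF (code partialSums) (code B ∷ tabulate projF)
  ; sound = λ xs → trans (sound partialSums (eval (code B) xs ∷ evalVec (tabulate projF) xs))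
                         (cong₂ (λ n ys → ∑[ i < n ] f (i ∷ ys)) (sound B xs)
                                (trans (evalVec-projs (λ i → i) xs) (tabulate∘lookup xs)))
  }
  where
  partialSums : IsPrimRec (λ xs → ∑[ i < head xs ] f (i ∷ tail xs))
  partialSums = recᴾ zeroᴾ (comp₂ addᴾ (projᴾ zero) (weakenᴾ F)) _ (λ _ → refl) (λ _ _ → refl)

-- Halving and binary digits

bit : ℕ → ℕ → ℕ
bit x i = x ≫ i % 2

x≫1+k≡[x/2]≫k : ∀ x k → x ≫ suc k ≡ (x / 2) ≫ k
x≫1+k≡[x/2]≫k x zero    = refl
x≫1+k≡[x/2]≫k x (suc k) = cong (_/ 2) (x≫1+k≡[x/2]≫k x k)

0≫k≡0 : ∀ k → 0 ≫ k ≡ 0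
0≫k≡0 zero    = refl
0≫k≡0 (suc k) = cong (_/ 2) (0≫k≡0 k)

bit-suc : ∀ x i → bit x (suc i) ≡ bit (x / 2) i
bit-suc x i = cong (_% 2) (x≫1+k≡[x/2]≫k x i)

bit≤1 : ∀ x i → bit x i ≤ 1
bit≤1 x i = s≤s⁻¹ (m%n<n (x ≫ i) 2)

[r+a*2]%2≡r : ∀ r a → r < 2 → (r + a * 2) % 2 ≡ r
[r+a*2]%2≡r r a r<2 = trans ([m+kn]%n≡m%n r a 2) (m<n⇒m%n≡m r<2)

[r+a*2]/2≡a : ∀ r a → r < 2 → (r + a * 2) / 2 ≡ a
[r+a*2]/2≡a r a r<2 = begin
  (r + a * 2) / 2     ≡⟨ +-distrib-/-∣ʳ r (n∣m*n a) ⟩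
  r / 2 + a * 2 / 2   ≡⟨ cong₂ _+_ (m<n⇒m/n≡0 r<2) (m*n/n≡m a 2) ⟩
  a                   ∎
  where open ≡-Reasoning

x≫k*2^k≤x : ∀ x k → x ≫ k * 2 ^ k ≤ x
x≫k*2^k≤x x zero    = ≤-reflexive (*-identityʳ x)
x≫k*2^k≤x x (suc k) = begin
  x ≫ k / 2 * (2 * 2 ^ k)   ≡⟨ *-assoc (x ≫ k / 2) 2 (2 ^ k) ⟨
  x ≫ k / 2 * 2 * 2 ^ k     ≤⟨ *-monoˡ-≤ (2 ^ k) (m/n*n≤m (x ≫ k) 2) ⟩
  x ≫ k * 2 ^ k             ≤⟨ x≫k*2^k≤x x k ⟩
  x                         ∎
  where open ≤-Reasoning

x<[1+x/2]*2 : ∀ x → x < suc (x / 2) * 2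
x<[1+x/2]*2 x = begin-strict
  x                   ≡⟨ m≡m%n+[m/n]*n x 2 ⟩
  x % 2 + x / 2 * 2   <⟨ +-monoˡ-< (x / 2 * 2) (m%n<n x 2) ⟩
  suc (x / 2) * 2     ∎
  where open ≤-Reasoning

x<[1+x≫k]*2^k : ∀ x k → x < suc (x ≫ k) * 2 ^ k
x<[1+x≫k]*2^k x zero    = s≤s (≤-reflexive (sym (*-identityʳ x)))
x<[1+x≫k]*2^k x (suc k) = begin-strict
  x                               <⟨ x<[1+x≫k]*2^k x k ⟩
  suc (x ≫ k) * 2 ^ k             ≤⟨ *-monoˡ-≤ (2 ^ k) (x<[1+x/2]*2 (x ≫ k)) ⟩
  suc (x ≫ k / 2) * 2 * 2 ^ k     ≡⟨ *-assoc (suc (x ≫ k / 2)) 2 (2 ^ k) ⟩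
  suc (x ≫ k / 2) * (2 * 2 ^ k)   ∎
  where open ≤-Reasoning

2^k≤x⇒1≤x≫k : ∀ x k → 2 ^ k ≤ x → 1 ≤ x ≫ k
2^k≤x⇒1≤x≫k x k 2^k≤x with x ≫ k | x<[1+x≫k]*2^k x k
... | zero  | x<2^k = contradiction 2^k≤x (<⇒≱ (subst (x <_) (+-identityʳ (2 ^ k)) x<2^k))
... | suc _ | _     = s≤s z≤n

x<2^k⇒x≫k≡0 : ∀ x k → x < 2 ^ k → x ≫ k ≡ 0
x<2^k⇒x≫k≡0 x k x<2^k with x ≫ k | x≫k*2^k≤x x k
... | zero  | _         = refl
... | suc q | [1+q]*2^k≤x = contradiction (≤-trans (m≤m+n (2 ^ k) (q * 2 ^ k)) [1+q]*2^k≤x) (<⇒≱ x<2^k)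

bit≡1⇒2^i≤x : ∀ x i → bit x i ≡ 1 → 2 ^ i ≤ x
bit≡1⇒2^i≤x x i b with 2 ^ i ≤? x
... | yes 2^i≤x = 2^i≤x
... | no  2^i≰x = contradiction (trans (sym b) (cong (_% 2) (x<2^k⇒x≫k≡0 x i (≰⇒> 2^i≰x)))) λ ()

n<2^n : ∀ n → n < 2 ^ n
n<2^n zero    = s≤s z≤n
n<2^n (suc n) = ≤-<-trans (n<2^n n) (m<m+n (2 ^ n) (≤-trans (m^n>0 2 n) (m≤m+n (2 ^ n) 0)))

fromBits : ℕ → (ℕ → ℕ) → ℕ
fromBits N b = ∑[ j < N ] b j * 2 ^ j

fromBits-suc : ∀ N b → fromBits (suc N) b ≡ b 0 + fromBits N (b ∘ suc) * 2
fromBits-suc zero    b = trans (*-identityʳ (b 0)) (sym (+-identityʳ (b 0)))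
fromBits-suc (suc N) b =
  trans (cong (_+ b (suc N) * 2 ^ suc N) (fromBits-suc N b))
        (regroup (b 0) (fromBits N (b ∘ suc)) (b (suc N)) (2 ^ N))
  where
  regroup : ∀ a t c p → a + t * 2 + c * (2 * p) ≡ a + (t + c * p) * 2
  regroup = solve-∀

fromBits-< : ∀ N b → (∀ j → b j ≤ 1) → fromBits N b < 2 ^ N
fromBits-< zero    b b≤1 = s≤s z≤n
fromBits-< (suc N) b b≤1 = +-mono-<-≤ (fromBits-< N b b≤1) (*-monoˡ-≤ (2 ^ N) (b≤1 N))

bit-fromBits-< : ∀ N b → (∀ j → b j ≤ 1) → ∀ i → i < N → bit (fromBits N b) i ≡ b i
bit-fromBits-< (suc N) b b≤1 zero    _         = begin
  fromBits (suc N) b % 2                 ≡⟨ cong (_% 2) (fromBits-suc N b) ⟩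
  (b 0 + fromBits N (b ∘ suc) * 2) % 2   ≡⟨ [r+a*2]%2≡r (b 0) (fromBits N (b ∘ suc)) (s≤s (b≤1 0)) ⟩
  b 0                                    ∎
  where open ≡-Reasoning
bit-fromBits-< (suc N) b b≤1 (suc i) (s≤s i<N) = begin
  bit (fromBits (suc N) b) (suc i)               ≡⟨ bit-suc (fromBits (suc N) b) i ⟩
  bit (fromBits (suc N) b / 2) i                 ≡⟨ cong (λ x → bit (x / 2) i) (fromBits-suc N b) ⟩
  bit ((b 0 + fromBits N (b ∘ suc) * 2) / 2) i
    ≡⟨ cong (λ x → bit x i) ([r+a*2]/2≡a (b 0) (fromBits N (b ∘ suc)) (s≤s (b≤1 0))) ⟩
  bit (fromBits N (b ∘ suc)) i                   ≡⟨ bit-fromBits-< N (b ∘ suc) (b≤1 ∘ suc) i i<N ⟩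
  b (suc i)                                      ∎
  where open ≡-Reasoning

bit-fromBits-≥ : ∀ N b → (∀ j → b j ≤ 1) → ∀ i → N ≤ i → bit (fromBits N b) i ≡ 0
bit-fromBits-≥ N b b≤1 i N≤i =
  cong (_% 2) (x<2^k⇒x≫k≡0 (fromBits N b) i (<-≤-trans (fromBits-< N b b≤1) (^-monoʳ-≤ 2 N≤i)))

-- Canonical indices of finite sets of strings

testBit : List Bool → ℕ → Bool
testBit []       i       = false
testBit (b ∷ bs) zero    = b
testBit (b ∷ bs) (suc i) = testBit bs i

Listed : ℕ → ℕ → List Bool → Set
Listed m k bs = ∃[ i ] m ≡ k + i × T (testBit bs i)

listed-∷ : ∀ {m k b bs} → Listed m (suc k) bs → Listed m k (b ∷ bs)
listed-∷ {k = k} (i , refl , t) = suc i , sym (+-suc k i) , t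

∈-ones⁻ : ∀ {m} k bs → m ∈ ones k bs → Listed m k bs
∈-ones⁻ k (true ∷ bs)  (here refl) = 0 , sym (+-identityʳ k) , tt
∈-ones⁻ k (true ∷ bs)  (there m∈)  = listed-∷ (∈-ones⁻ (suc k) bs m∈)
∈-ones⁻ k (false ∷ bs) m∈          = listed-∷ (∈-ones⁻ (suc k) bs m∈)

∈-ones⁺ : ∀ k bs i → T (testBit bs i) → k + i ∈ ones k bs
∈-ones⁺ k (true ∷ bs)  zero    _ = here (+-identityʳ k)
∈-ones⁺ k (true ∷ bs)  (suc i) t = there (subst (_∈ ones (suc k) bs) (sym (+-suc k i)) (∈-ones⁺ (suc k) bs i t))
∈-ones⁺ k (false ∷ bs) (suc i) t = subst (_∈ ones (suc k) bs) (sym (+-suc k i)) (∈-ones⁺ (suc k) bs i t)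

testBit-digits : ∀ f x i → x ≤ f → testBit (digits f x) i ≡ (bit x i ≡ᵇ 1)
testBit-digits zero    zero    i _ = cong (λ y → y % 2 ≡ᵇ 1) (sym (0≫k≡0 i))
testBit-digits (suc f) zero    i _ = cong (λ y → y % 2 ≡ᵇ 1) (sym (0≫k≡0 i))
testBit-digits (suc f) (suc m) zero    _         = refl
testBit-digits (suc f) (suc m) (suc i) (s≤s m≤f) = begin
  testBit (digits f (suc m / 2)) i
    ≡⟨ testBit-digits f (suc m / 2) i (≤-trans (s≤s⁻¹ (m/n<m (suc m) 2 (s≤s (s≤s z≤n)))) m≤f) ⟩
  (bit (suc m / 2) i ≡ᵇ 1)     ≡⟨ cong (_≡ᵇ 1) (bit-suc (suc m) i) ⟨
  (bit (suc m) (suc i) ≡ᵇ 1)   ∎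
  where open ≡-Reasoning

∈-ones-digits⁻ : ∀ x {i} → i ∈ ones 0 (digits x x) → bit x i ≡ 1
∈-ones-digits⁻ x i∈ with ∈-ones⁻ 0 (digits x x) i∈
... | i , refl , t = ≡ᵇ⇒≡ (bit x i) 1 (subst T (testBit-digits x x i ≤-refl) t)

∈-ones-digits⁺ : ∀ x {i} → bit x i ≡ 1 → i ∈ ones 0 (digits x x)
∈-ones-digits⁺ x {i} b =
  ∈-ones⁺ 0 (digits x x) i (subst T (sym (testBit-digits x x i ≤-refl)) (≡⇒≡ᵇ (bit x i) 1 b))

∈⟦decodeSet⟧⁻ : ∀ x X → X ∈⟦ decodeSet x ⟧ → ∃[ i ] bit x i ≡ 1 × decodeStr i ⊏ X
∈⟦decodeSet⟧⁻ x X X∈ with find (Any.map⁻ X∈)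
... | i , i∈ , i⊏X = i , ∈-ones-digits⁻ x i∈ , i⊏X

∈⟦decodeSet⟧⁺ : ∀ x X i → bit x i ≡ 1 → decodeStr i ⊏ X → X ∈⟦ decodeSet x ⟧
∈⟦decodeSet⟧⁺ x X i b i⊏X = Any.map⁺ (lose {P = λ j → decodeStr j ⊏ X} (∈-ones-digits⁺ x {i} b) i⊏X)

All-decodeSet : ∀ x (P : Str → Set) → (∀ i → bit x i ≡ 1 → P (decodeStr i)) → All P (decodeSet x)
All-decodeSet x P h = All.map⁺ (All.tabulate {P = P ∘ decodeStr} λ {i} i∈ → h i (∈-ones-digits⁻ x i∈))

-- The binary expansion of x ≥ 1 with its leading 1 removed; decodeStr c is binTail (suc c) by definition.
binTail : ℕ → Str
binTail x = reverse (dropLast (digits x x))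

bitValue : Bool → ℕ
bitValue false = 0
bitValue true  = 1

appendBit : ℕ → Bool → ℕ
appendBit a b = bitValue b + a * 2

binVal : Str → ℕ
binVal = foldl appendBit 1

encodeStr : Str → ℕ
encodeStr σ = pred (binVal σ)

digits-fuel : ∀ {f f′} x → x ≤ f → x ≤ f′ → digits f x ≡ digits f′ x
digits-fuel {zero}  {zero}   zero    _         _          = refl
digits-fuel {zero}  {suc _}  zero    _         _          = refl
digits-fuel {suc _} {zero}   zero    _         _          = refl
digits-fuel {suc _} {suc _}  zero    _         _          = refl
digits-fuel {suc f} {suc f′} (suc m) (s≤s m≤f) (s≤s m≤f′) =
  cong (_ ∷_) (digits-fuel (suc m / 2) (≤-trans [1+m]/2≤m m≤f) (≤-trans [1+m]/2≤m m≤f′))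
  where [1+m]/2≤m = s≤s⁻¹ (m/n<m (suc m) 2 (s≤s (s≤s z≤n)))

binTail-/2 : ∀ x → 2 ≤ x → binTail x ≡ binTail (x / 2) ++ [ x % 2 ≡ᵇ 1 ]
binTail-/2 (suc zero)    (s≤s ())
binTail-/2 (suc (suc n)) _ = begin
  reverse (dropLast (b ∷ digits (suc n) ((2 + n) / 2)))
    ≡⟨ cong (λ y → reverse (dropLast (b ∷ digits (suc n) y))) ([2+n]/2≡1+n/2 n) ⟩
  reverse (dropLast (b ∷ digits (suc n) h))
    ≡⟨ cong (λ ds → reverse (dropLast (b ∷ ds))) (digits-fuel h (s≤s (m/n≤m n 2)) ≤-refl) ⟩
  reverse (b ∷ dropLast (digits h h))   ≡⟨ unfold-reverse b (dropLast (digits h h)) ⟩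
  binTail h ++ [ b ]                    ≡⟨ cong (λ y → binTail y ++ [ b ]) ([2+n]/2≡1+n/2 n) ⟨
  binTail ((2 + n) / 2) ++ [ b ]        ∎
  where
  open ≡-Reasoning
  b = (2 + n) % 2 ≡ᵇ 1
  h = suc (n / 2)

bitValue<2 : ∀ b → bitValue b < 2
bitValue<2 false = s≤s z≤n
bitValue<2 true  = s≤s (s≤s z≤n)

bitValue-≡ᵇ1 : ∀ b → (bitValue b ≡ᵇ 1) ≡ b
bitValue-≡ᵇ1 false = refl
bitValue-≡ᵇ1 true  = refl

bitValue-[r≡ᵇ1] : ∀ r → r < 2 → bitValue (r ≡ᵇ 1) ≡ r
bitValue-[r≡ᵇ1] zero          _ = refl
bitValue-[r≡ᵇ1] (suc zero)    _ = refl
bitValue-[r≡ᵇ1] (suc (suc _)) (s≤s (s≤s ()))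

appendBit-%2 : ∀ a b → appendBit a b % 2 ≡ bitValue b
appendBit-%2 a b = [r+a*2]%2≡r (bitValue b) a (bitValue<2 b)

appendBit-/2 : ∀ a b → appendBit a b / 2 ≡ a
appendBit-/2 a b = [r+a*2]/2≡a (bitValue b) a (bitValue<2 b)

appendBit-/2-%2 : ∀ x → appendBit (x / 2) (x % 2 ≡ᵇ 1) ≡ x
appendBit-/2-%2 x = begin
  bitValue (x % 2 ≡ᵇ 1) + x / 2 * 2   ≡⟨ cong (_+ x / 2 * 2) (bitValue-[r≡ᵇ1] (x % 2) (m%n<n x 2)) ⟩
  x % 2 + x / 2 * 2                   ≡⟨ m≡m%n+[m/n]*n x 2 ⟨
  x                                   ∎
  where open ≡-Reasoning

2≤appendBit : ∀ a b → 1 ≤ a → 2 ≤ appendBit a b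
2≤appendBit a b 1≤a = ≤-trans (*-monoˡ-≤ 2 1≤a) (m≤n+m (a * 2) (bitValue b))

binTail-appendBit : ∀ a b → 1 ≤ a → binTail (appendBit a b) ≡ binTail a ++ [ b ]
binTail-appendBit a b 1≤a = begin
  binTail (appendBit a b)
    ≡⟨ binTail-/2 (appendBit a b) (2≤appendBit a b 1≤a) ⟩
  binTail (appendBit a b / 2) ++ [ appendBit a b % 2 ≡ᵇ 1 ]
    ≡⟨ cong₂ (λ y r → binTail y ++ [ r ≡ᵇ 1 ]) (appendBit-/2 a b) (appendBit-%2 a b) ⟩
  binTail a ++ [ bitValue b ≡ᵇ 1 ]
    ≡⟨ cong (λ r → binTail a ++ [ r ]) (bitValue-≡ᵇ1 b) ⟩
  binTail a ++ [ b ]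
    ∎
  where open ≡-Reasoning

1≤foldl-appendBit : ∀ a σ → 1 ≤ a → 1 ≤ foldl appendBit a σ
1≤foldl-appendBit a []      1≤a = 1≤a
1≤foldl-appendBit a (b ∷ σ) 1≤a =
  1≤foldl-appendBit (appendBit a b) σ (≤-trans (s≤s z≤n) (2≤appendBit a b 1≤a))

binTail-foldl : ∀ a σ → 1 ≤ a → binTail (foldl appendBit a σ) ≡ binTail a ++ σ
binTail-foldl a []      1≤a = sym (++-identityʳ (binTail a))
binTail-foldl a (b ∷ σ) 1≤a = begin
  binTail (foldl appendBit (appendBit a b) σ)
    ≡⟨ binTail-foldl (appendBit a b) σ (≤-trans (s≤s z≤n) (2≤appendBit a b 1≤a)) ⟩
  binTail (appendBit a b) ++ σ   ≡⟨ cong (_++ σ) (binTail-appendBit a b 1≤a) ⟩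
  (binTail a ++ [ b ]) ++ σ      ≡⟨ ++-assoc (binTail a) [ b ] σ ⟩
  binTail a ++ b ∷ σ             ∎
  where open ≡-Reasoning

binTail-binVal : ∀ σ → binTail (binVal σ) ≡ σ
binTail-binVal σ = binTail-foldl 1 σ ≤-refl

binVal-binTail : ∀ x → 1 ≤ x → binVal (binTail x) ≡ x
binVal-binTail = <-rec _ step
  where
  step : ∀ x → (∀ {y} → y < x → 1 ≤ y → binVal (binTail y) ≡ y) → 1 ≤ x → binVal (binTail x) ≡ x
  step (suc zero)        _   _ = refl
  step x@(suc (suc n)) rec _ = begin
    binVal (binTail x)                                  ≡⟨ cong binVal (binTail-/2 x (s≤s (s≤s z≤n))) ⟩
    binVal (binTail (x / 2) ++ [ x % 2 ≡ᵇ 1 ])          ≡⟨ foldl-++ appendBit 1 (binTail (x / 2)) [ x % 2 ≡ᵇ 1 ] ⟩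
    appendBit (binVal (binTail (x / 2))) (x % 2 ≡ᵇ 1)   ≡⟨ cong (λ y → appendBit y (x % 2 ≡ᵇ 1)) x/2-fixed ⟩
    appendBit (x / 2) (x % 2 ≡ᵇ 1)                      ≡⟨ appendBit-/2-%2 x ⟩
    x                                                   ∎
    where
    open ≡-Reasoning
    x/2-fixed : binVal (binTail (x / 2)) ≡ x / 2
    x/2-fixed = rec (m/n<m x 2 (s≤s (s≤s z≤n))) (m≥n⇒m/n>0 {x} {2} (s≤s (s≤s z≤n)))

foldl-appendBit-≥ : ∀ a σ → a * 2 ^ length σ ≤ foldl appendBit a σ
foldl-appendBit-≥ a []      = ≤-reflexive (*-identityʳ a)
foldl-appendBit-≥ a (b ∷ σ) = begin
  a * (2 * 2 ^ length σ)             ≡⟨ *-assoc a 2 (2 ^ length σ) ⟨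
  a * 2 * 2 ^ length σ               ≤⟨ *-monoˡ-≤ (2 ^ length σ) (m≤n+m (a * 2) (bitValue b)) ⟩
  appendBit a b * 2 ^ length σ       ≤⟨ foldl-appendBit-≥ (appendBit a b) σ ⟩
  foldl appendBit (appendBit a b) σ  ∎
  where open ≤-Reasoning

foldl-appendBit-< : ∀ a σ → foldl appendBit a σ < suc a * 2 ^ length σ
foldl-appendBit-< a []      = s≤s (≤-reflexive (sym (*-identityʳ a)))
foldl-appendBit-< a (b ∷ σ) = begin-strict
  foldl appendBit (appendBit a b) σ    <⟨ foldl-appendBit-< (appendBit a b) σ ⟩
  suc (appendBit a b) * 2 ^ length σ   ≤⟨ *-monoˡ-≤ (2 ^ length σ) (+-monoˡ-≤ (a * 2) (bitValue<2 b)) ⟩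
  suc a * 2 * 2 ^ length σ             ≡⟨ *-assoc (suc a) 2 (2 ^ length σ) ⟩
  suc a * (2 * 2 ^ length σ)           ∎
  where open ≤-Reasoning

2^length≤binVal : ∀ σ → 2 ^ length σ ≤ binVal σ
2^length≤binVal σ = ≤-trans (≤-reflexive (sym (*-identityˡ (2 ^ length σ)))) (foldl-appendBit-≥ 1 σ)

binVal<2^1+length : ∀ σ → binVal σ < 2 ^ suc (length σ)
binVal<2^1+length σ = foldl-appendBit-< 1 σ

foldl-appendBit-≫ : ∀ a τ → foldl appendBit a τ ≫ length τ ≡ a
foldl-appendBit-≫ a []      = refl
foldl-appendBit-≫ a (b ∷ τ) = trans (cong (_/ 2) (foldl-appendBit-≫ (appendBit a b) τ)) (appendBit-/2 a b)

binVal-++-≫ : ∀ σ τ → binVal (σ ++ τ) ≫ length τ ≡ binVal σ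
binVal-++-≫ σ τ = trans (cong (_≫ length τ) (foldl-++ appendBit 1 σ τ)) (foldl-appendBit-≫ (binVal σ) τ)

length-binTail : ∀ c x → 2 ^ c ≤ x → x < 2 ^ suc c → length (binTail x) ≡ c
length-binTail c x 2^c≤x x<2^1+c = ≤-antisym
  (≮⇒≥ λ c<ℓ → <⇒≱ x<2^1+c (≤-trans (^-monoʳ-≤ 2 c<ℓ) 2^ℓ≤x))
  (≮⇒≥ λ ℓ<c → <⇒≱ x<2^1+ℓ (≤-trans (^-monoʳ-≤ 2 ℓ<c) 2^c≤x))
  where
  ℓ = length (binTail x)
  x≡binVal : binVal (binTail x) ≡ x
  x≡binVal = binVal-binTail x (≤-trans (m^n>0 2 c) 2^c≤x)
  2^ℓ≤x : 2 ^ ℓ ≤ x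
  2^ℓ≤x = subst (2 ^ ℓ ≤_) x≡binVal (2^length≤binVal (binTail x))
  x<2^1+ℓ : x < 2 ^ suc ℓ
  x<2^1+ℓ = subst (_< 2 ^ suc ℓ) x≡binVal (binVal<2^1+length (binTail x))

1≤x/2⇒2≤x : ∀ x → 1 ≤ x / 2 → 2 ≤ x
1≤x/2⇒2≤x x 1≤x/2 = m/n≢0⇒n≤m {x} {2} λ x/2≡0 → contradiction (subst (1 ≤_) x/2≡0 1≤x/2) λ ()

binTail-≫ : ∀ x k → 1 ≤ x ≫ k → ∃[ τ ] binTail x ≡ binTail (x ≫ k) ++ τ
binTail-≫ x zero    _ = [] , sym (++-identityʳ (binTail x))
binTail-≫ x (suc k) 1≤x≫1+k
  with 2≤x≫k ← 1≤x/2⇒2≤x (x ≫ k) 1≤x≫1+k | binTail-≫ x k (≤-trans (s≤s z≤n) 2≤x≫k)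
... | τ , split = b ∷ τ , (begin
  binTail x                                ≡⟨ split ⟩
  binTail (x ≫ k) ++ τ                     ≡⟨ cong (_++ τ) (binTail-/2 (x ≫ k) 2≤x≫k) ⟩
  (binTail (x ≫ k / 2) ++ [ b ]) ++ τ      ≡⟨ ++-assoc (binTail (x ≫ k / 2)) [ b ] τ ⟩
  binTail (x ≫ k / 2) ++ b ∷ τ             ∎)
  where
  open ≡-Reasoning
  b = x ≫ k % 2 ≡ᵇ 1

suc-encodeStr : ∀ σ → suc (encodeStr σ) ≡ binVal σ
suc-encodeStr σ = suc-pred (binVal σ) {{>-nonZero (1≤foldl-appendBit 1 σ ≤-refl)}}

decodeStr-encodeStr : ∀ σ → decodeStr (encodeStr σ) ≡ σ
decodeStr-encodeStr σ = trans (cong binTail (suc-encodeStr σ)) (binTail-binVal σ)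

encodeStr-decodeStr : ∀ i → encodeStr (decodeStr i) ≡ i
encodeStr-decodeStr i = cong pred (binVal-binTail (suc i) (s≤s z≤n))

length-decodeStr≤ : ∀ i → length (decodeStr i) ≤ i
length-decodeStr≤ i = s≤s⁻¹ (<-≤-trans (n<2^n (length σ)) 2^∣σ∣≤1+i)
  where
  σ = decodeStr i
  2^∣σ∣≤1+i : 2 ^ length σ ≤ suc i
  2^∣σ∣≤1+i = subst (2 ^ length σ ≤_) (binVal-binTail (suc i) (s≤s z≤n)) (2^length≤binVal σ)

bit≡1⇒length-decodeStr< : ∀ x i → bit x i ≡ 1 → length (decodeStr i) < x
bit≡1⇒length-decodeStr< x i b = ≤-<-trans (length-decodeStr≤ i) (<-≤-trans (n<2^n i) (bit≡1⇒2^i≤x x i b))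

-- Padding a finite set of strings to a common length

sḡ : ℕ → ℕ
sḡ x = 1 ∸ x

sg : ℕ → ℕ
sg x = sḡ (sḡ x)

sḡ≤1 : ∀ x → sḡ x ≤ 1
sḡ≤1 x = m∸n≤m 1 x

sg≤1 : ∀ x → sg x ≤ 1
sg≤1 x = sḡ≤1 (sḡ x)

sḡ≡1⇒≡0 : ∀ x → sḡ x ≡ 1 → x ≡ 0
sḡ≡1⇒≡0 zero    _  = refl
sḡ≡1⇒≡0 (suc x) eq = contradiction (trans (sym (0∸n≡0 x)) eq) λ ()

sg≡1⇒1≤ : ∀ x → sg x ≡ 1 → 1 ≤ x
sg≡1⇒1≤ x eq = n≢0⇒n>0 λ x≡0 → contradiction (trans (sym (cong sg x≡0)) eq) λ ()

∑-pos : ∀ n (f : ℕ → ℕ) → 1 ≤ ∑[ i < n ] f i → ∃[ i ] i < n × 1 ≤ f i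
∑-pos (suc n) f pos with 1 ≤? f n
... | yes 1≤fn = n , ≤-refl , 1≤fn
... | no  1≰fn = let i , i<n , 1≤fi = ∑-pos n f 1≤∑ in i , m≤n⇒m≤1+n i<n , 1≤fi
  where
  1≤∑ : 1 ≤ ∑[ i < n ] f i
  1≤∑ = subst (1 ≤_) (trans (cong ((∑[ i < n ] f i) +_) (n<1⇒n≡0 (≰⇒> 1≰fn))) (+-identityʳ _)) pos

term≤∑ : ∀ n (f : ℕ → ℕ) i → i < n → f i ≤ ∑[ j < n ] f j
term≤∑ (suc n) f i i<1+n with m≤n⇒m<n∨m≡n (s≤s⁻¹ i<1+n)
... | inj₁ i<n  = ≤-trans (term≤∑ n f i i<n) (m≤m+n (∑[ j < n ] f j) (f n))
... | inj₂ refl = m≤n+m (f i) (∑[ j < n ] f j)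

-- With ρ = decodeStr j: |ρ| ≥ c iff 2 ^ c ≤ suc j, and pred (suc j ≫ k) is the index of ρ
-- with its last k bits dropped. The bound on j in pad c rules out |ρ| > c.
prefixHits : ℕ → ℕ → ℕ
prefixHits c j = ∑[ k < suc c ] bit c (pred (suc j ≫ k))

padIndicator : ℕ → ℕ → ℕ
padIndicator c j = sḡ (2 ^ c ∸ suc j) * sg (prefixHits c j)

pad : ℕ → ℕ
pad c = fromBits (pred (2 ^ suc c)) (padIndicator c)

padIndicator≤1 : ∀ c j → padIndicator c j ≤ 1
padIndicator≤1 c j = *-mono-≤ (sḡ≤1 (2 ^ c ∸ suc j)) (sg≤1 (prefixHits c j))

padIndicator≡1⇒2^c≤1+j : ∀ c j → padIndicator c j ≡ 1 → 2 ^ c ≤ suc j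
padIndicator≡1⇒2^c≤1+j c j eq =
  m∸n≡0⇒m≤n (sḡ≡1⇒≡0 (2 ^ c ∸ suc j) (m*n≡1⇒m≡1 (sḡ (2 ^ c ∸ suc j)) (sg (prefixHits c j)) eq))

padIndicator≡1⇒hit : ∀ c j → padIndicator c j ≡ 1 → ∃[ k ] k ≤ c × bit c (pred (suc j ≫ k)) ≡ 1
padIndicator≡1⇒hit c j eq
  with ∑-pos (suc c) (λ k → bit c (pred (suc j ≫ k)))
             (sg≡1⇒1≤ (prefixHits c j) (m*n≡1⇒n≡1 (sḡ (2 ^ c ∸ suc j)) (sg (prefixHits c j)) eq))
... | k , k<1+c , 1≤hit = k , s≤s⁻¹ k<1+c , ≤-antisym (bit≤1 c (pred (suc j ≫ k))) 1≤hit

padIndicator≡1⇐ : ∀ c j k → 2 ^ c ≤ suc j → k ≤ c → bit c (pred (suc j ≫ k)) ≡ 1 → padIndicator c j ≡ 1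
padIndicator≡1⇐ c j k 2^c≤1+j k≤c hit
  rewrite m≤n⇒m∸n≡0 2^c≤1+j
        | m≤n⇒m∸n≡0 {1} {prefixHits c j} (subst (_≤ prefixHits c j) hit
                                                (term≤∑ (suc c) (λ k → bit c (pred (suc j ≫ k))) k (s≤s k≤c)))
  = refl

<pred⇒1+< : ∀ j n → j < pred n → suc j < n
<pred⇒1+< j (suc n) j<n = s≤s j<n

bit-pad≡1⇒ : ∀ c j → bit (pad c) j ≡ 1 → j < pred (2 ^ suc c) × padIndicator c j ≡ 1
bit-pad≡1⇒ c j b with j <? pred (2 ^ suc c)
... | yes j<N = j<N , trans (sym (bit-fromBits-< _ (padIndicator c) (padIndicator≤1 c) j j<N)) b
... | no  j≮N =
  contradiction (trans (sym b) (bit-fromBits-≥ _ (padIndicator c) (padIndicator≤1 c) j (≮⇒≥ j≮N))) λ ()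

bit-pad⁻ : ∀ c j → bit (pad c) j ≡ 1 →
           length (decodeStr j) ≡ c × ∃[ σ ] ∃[ τ ] decodeStr j ≡ σ ++ τ × bit c (encodeStr σ) ≡ 1
bit-pad⁻ c j b with bit-pad≡1⇒ c j b
... | j<N , on with padIndicator≡1⇒hit c j on
...   | k , k≤c , hit =
  length-binTail c (suc j) 2^c≤1+j (<pred⇒1+< j (2 ^ suc c) j<N) ,
  binTail (suc j ≫ k) , proj₁ split , proj₂ split ,
  subst (λ y → bit c (pred y) ≡ 1) (sym (binVal-binTail (suc j ≫ k) 1≤1+j≫k)) hit
  where
  2^c≤1+j = padIndicator≡1⇒2^c≤1+j c j on
  1≤1+j≫k = 2^k≤x⇒1≤x≫k (suc j) k (≤-trans (^-monoʳ-≤ 2 k≤c) 2^c≤1+j)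
  split = binTail-≫ (suc j) k 1≤1+j≫k

bit-pad⁺ : ∀ c σ τ → length (σ ++ τ) ≡ c → bit c (encodeStr σ) ≡ 1 → bit (pad c) (encodeStr (σ ++ τ)) ≡ 1
bit-pad⁺ c σ τ ∣ρ∣≡c hit = trans (bit-fromBits-< _ (padIndicator c) (padIndicator≤1 c) j j<N) on
  where
  ρ = σ ++ τ
  j = encodeStr ρ
  1+j≡binVal : suc j ≡ binVal ρ
  1+j≡binVal = suc-encodeStr ρ
  j<N : j < pred (2 ^ suc c)
  j<N = pred-mono-≤ (subst₂ (λ y n → suc y ≤ 2 ^ suc n) (sym 1+j≡binVal) ∣ρ∣≡c (binVal<2^1+length ρ))
  2^c≤1+j : 2 ^ c ≤ suc j
  2^c≤1+j = subst₂ (λ n y → 2 ^ n ≤ y) ∣ρ∣≡c (sym 1+j≡binVal) (2^length≤binVal ρ)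
  ∣τ∣≤c : length τ ≤ c
  ∣τ∣≤c = subst (length τ ≤_) (trans (sym (length-++ σ)) ∣ρ∣≡c) (m≤n+m (length τ) (length σ))
  1+j≫∣τ∣ : suc j ≫ length τ ≡ binVal σ
  1+j≫∣τ∣ = trans (cong (_≫ length τ) 1+j≡binVal) (binVal-++-≫ σ τ)
  on : padIndicator c j ≡ 1
  on = padIndicator≡1⇐ c j (length τ) 2^c≤1+j ∣τ∣≤c (subst (λ y → bit c (pred y) ≡ 1) (sym 1+j≫∣τ∣) hit)

applyUpTo-⊏ : ∀ n X → applyUpTo X n ⊏ X
applyUpTo-⊏ zero    X = tt
applyUpTo-⊏ (suc n) X = refl , applyUpTo-⊏ n (X ∘ suc)

⊏⇒applyUpTo≡++ : ∀ σ n X → σ ⊏ X → length σ ≤ n → ∃[ τ ] applyUpTo X n ≡ σ ++ τ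
⊏⇒applyUpTo≡++ []      n       X _          _         = applyUpTo X n , refl
⊏⇒applyUpTo≡++ (b ∷ σ) (suc n) X (b≡ , σ⊏) (s≤s σ≤n) with ⊏⇒applyUpTo≡++ σ n (X ∘ suc) σ⊏ σ≤n
... | τ , eq = τ , cong₂ _∷_ (sym b≡) eq

++-⊏⇒⊏ : ∀ σ τ X → (σ ++ τ) ⊏ X → σ ⊏ X
++-⊏⇒⊏ []      τ X _          = tt
++-⊏⇒⊏ (b ∷ σ) τ X (b≡ , σ⊏) = b≡ , ++-⊏⇒⊏ σ τ (X ∘ suc) σ⊏

All-length-pad : ∀ c → All (λ τ → length τ ≡ c) (decodeSet (pad c))
All-length-pad c = All-decodeSet (pad c) (λ τ → length τ ≡ c) λ j b → proj₁ (bit-pad⁻ c j b)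

⟦pad⟧⊆ : ∀ c X → X ∈⟦ decodeSet (pad c) ⟧ → X ∈⟦ decodeSet c ⟧
⟦pad⟧⊆ c X X∈ with ∈⟦decodeSet⟧⁻ (pad c) X X∈
... | j , b , j⊏X with bit-pad⁻ c j b
...   | _ , σ , τ , split , hit =
  ∈⟦decodeSet⟧⁺ c X (encodeStr σ) hit
    (subst (_⊏ X) (sym (decodeStr-encodeStr σ)) (++-⊏⇒⊏ σ τ X (subst (_⊏ X) split j⊏X)))

⊆⟦pad⟧ : ∀ c X → X ∈⟦ decodeSet c ⟧ → X ∈⟦ decodeSet (pad c) ⟧
⊆⟦pad⟧ c X X∈ with ∈⟦decodeSet⟧⁻ c X X∈
... | i , b , i⊏X with ⊏⇒applyUpTo≡++ (decodeStr i) c X i⊏X (<⇒≤ (bit≡1⇒length-decodeStr< c i b))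
...   | τ , eq =
  ∈⟦decodeSet⟧⁺ (pad c) X (encodeStr ρ) (bit-pad⁺ c σ τ ∣ρ∣≡c hit)
    (subst (_⊏ X) (trans eq (sym (decodeStr-encodeStr ρ))) (applyUpTo-⊏ c X))
  where
  σ = decodeStr i
  ρ = σ ++ τ
  ∣ρ∣≡c : length ρ ≡ c
  ∣ρ∣≡c = trans (cong length (sym eq)) (length-applyUpTo X c)
  hit : bit c (encodeStr σ) ≡ 1
  hit = subst (λ y → bit c y ≡ 1) (sym (encodeStr-decodeStr i)) b

bitᴾ : IsPrimRec₂ bit
bitᴾ = castᴾ (λ { (x ∷ i ∷ []) → refl }) (comp₁ parityᴾ (comp₂ ≫ᴾ (projᴾ (suc zero)) (projᴾ zero)))

sḡᴾ : IsPrimRec₁ sḡ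
sḡᴾ = castᴾ (λ { (x ∷ []) → refl }) (comp₂ monusᴾ oneᴾ (projᴾ zero))

sgᴾ : IsPrimRec₁ sg
sgᴾ = castᴾ (λ { (x ∷ []) → refl }) (comp₁ sḡᴾ sḡᴾ)

prefixHitsᴾ : IsPrimRec₂ prefixHits
prefixHitsᴾ = castᴾ (λ { (c ∷ j ∷ []) → refl }) (∑ᴾ hitᴾ (comp₁ succᴾ (projᴾ zero)))
  where
  hitᴾ : IsPrimRec (λ { (k ∷ c ∷ j ∷ []) → bit c (pred (suc j ≫ k)) })
  hitᴾ = castᴾ (λ { (k ∷ c ∷ j ∷ []) → refl })
    (comp₂ bitᴾ (projᴾ (suc zero)) (comp₁ predᴾ (comp₂ ≫ᴾ (projᴾ zero) (comp₁ succᴾ (projᴾ (suc (suc zero)))))))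

padIndicatorᴾ : IsPrimRec₂ padIndicator
padIndicatorᴾ = castᴾ (λ { (c ∷ j ∷ []) → refl })
  (comp₂ mulᴾ (comp₁ sḡᴾ (comp₂ monusᴾ (comp₁ pow2ᴾ (projᴾ zero)) (comp₁ succᴾ (projᴾ (suc zero)))))
              (comp₁ sgᴾ prefixHitsᴾ))

padᴾ : IsPrimRec₁ pad
padᴾ = castᴾ (λ { (c ∷ []) → refl })
  (∑ᴾ (comp₂ mulᴾ (comp₂ padIndicatorᴾ (projᴾ (suc zero)) (projᴾ zero)) (comp₁ pow2ᴾ (projᴾ zero)))
      (comp₁ predᴾ (comp₁ pow2ᴾ (comp₁ succᴾ (projᴾ zero)))))

-- Measures of clopen sets

count : ℕ → (Str → Bool) → ℕ
count L P = length (filterᵇ P (allStr L))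

length-filterᵇ-++ : ∀ (P : Str → Bool) xs ys →
                    length (filterᵇ P (xs ++ ys)) ≡ length (filterᵇ P xs) + length (filterᵇ P ys)
length-filterᵇ-++ P xs ys = trans (cong length (filter-++ (T? ∘ P) xs ys)) (length-++ (filterᵇ P xs))

length-filterᵇ-map : ∀ (P : Str → Bool) (f : Str → Str) xs →
                     length (filterᵇ P (map f xs)) ≡ length (filterᵇ (P ∘ f) xs)
length-filterᵇ-map P f []       = refl
length-filterᵇ-map P f (x ∷ xs) with P (f x)
... | true  = cong suc (length-filterᵇ-map P f xs)
... | false = length-filterᵇ-map P f xs

length-filterᵇ-∧ : ∀ (P Q : Str → Bool) xs → length (filterᵇ (λ ρ → P ρ ∧ Q ρ) xs) ≤ length (filterᵇ P xs)
length-filterᵇ-∧ P Q []       = z≤n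
length-filterᵇ-∧ P Q (x ∷ xs) with P x | Q x
... | true  | true  = s≤s (length-filterᵇ-∧ P Q xs)
... | true  | false = m≤n⇒m≤1+n (length-filterᵇ-∧ P Q xs)
... | false | _     = length-filterᵇ-∧ P Q xs

count-suc : ∀ L P → count (suc L) P ≡ count L (P ∘ (true ∷_)) + count L (P ∘ (false ∷_))
count-suc L P = trans (length-filterᵇ-++ P (map (true ∷_) (allStr L)) (map (false ∷_) (allStr L)))
                      (cong₂ _+_ (length-filterᵇ-map P (true ∷_) (allStr L))
                                 (length-filterᵇ-map P (false ∷_) (allStr L)))

count-0-cong : ∀ P Q → P [] ≡ Q [] → count 0 P ≡ count 0 Q
count-0-cong P Q eq with P [] | Q []
count-0-cong P Q refl | true  | true  = refl
count-0-cong P Q refl | false | false = refl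

DependsOnFirst : ℕ → (Str → Bool) → Set
DependsOnFirst L P = ∀ σ τ τ′ → length σ ≡ L → P (σ ++ τ) ≡ P (σ ++ τ′)

count-refine : ∀ L P → DependsOnFirst L P → ∀ k → count (L + k) P ≡ count L P * 2 ^ k
count-refine zero    P dep zero    = sym (*-identityʳ (count 0 P))
count-refine zero    P dep (suc k) = begin
  count (suc k) P                                            ≡⟨ count-suc k P ⟩
  count k (P ∘ (true ∷_)) + count k (P ∘ (false ∷_))
    ≡⟨ cong₂ _+_ (count-refine 0 _ (constant true) k) (count-refine 0 _ (constant false) k) ⟩
  count 0 (P ∘ (true ∷_)) * 2 ^ k + count 0 (P ∘ (false ∷_)) * 2 ^ k
    ≡⟨ cong₂ (λ a b → a * 2 ^ k + b * 2 ^ k) (count-0-cong (P ∘ (true ∷_)) P (dep [] [ true ] [] refl))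
                                              (count-0-cong (P ∘ (false ∷_)) P (dep [] [ false ] [] refl)) ⟩
  count 0 P * 2 ^ k + count 0 P * 2 ^ k                      ≡⟨ double (count 0 P) (2 ^ k) ⟩
  count 0 P * 2 ^ suc k                                      ∎
  where
  open ≡-Reasoning
  constant : ∀ b → DependsOnFirst 0 (P ∘ (b ∷_))
  constant b σ τ τ′ _ = dep [] (b ∷ σ ++ τ) (b ∷ σ ++ τ′) refl
  double : ∀ a p → a * p + a * p ≡ a * (2 * p)
  double = solve-∀
count-refine (suc L) P dep k = begin
  count (suc L + k) P                                                 ≡⟨ count-suc (L + k) P ⟩
  count (L + k) (P ∘ (true ∷_)) + count (L + k) (P ∘ (false ∷_))
    ≡⟨ cong₂ _+_ (count-refine L _ (λ σ τ τ′ eq → dep (true ∷ σ) τ τ′ (cong suc eq)) k)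
                 (count-refine L _ (λ σ τ τ′ eq → dep (false ∷ σ) τ τ′ (cong suc eq)) k) ⟩
  count L (P ∘ (true ∷_)) * 2 ^ k + count L (P ∘ (false ∷_)) * 2 ^ k
    ≡⟨ *-distribʳ-+ (2 ^ k) (count L (P ∘ (true ∷_))) (count L (P ∘ (false ∷_))) ⟨
  (count L (P ∘ (true ∷_)) + count L (P ∘ (false ∷_))) * 2 ^ k       ≡⟨ cong (_* 2 ^ k) (count-suc L P) ⟨
  count (suc L) P * 2 ^ k                                             ∎
  where open ≡-Reasoning

⊑ᵇ-++ : ∀ s σ τ → length s ≤ length σ → s ⊑ᵇ (σ ++ τ) ≡ s ⊑ᵇ σ
⊑ᵇ-++ []          σ           τ _         = refl
⊑ᵇ-++ (true ∷ s)  (true ∷ σ)  τ (s≤s s≤σ) = ⊑ᵇ-++ s σ τ s≤σ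
⊑ᵇ-++ (true ∷ s)  (false ∷ σ) τ _         = refl
⊑ᵇ-++ (false ∷ s) (true ∷ σ)  τ _         = refl
⊑ᵇ-++ (false ∷ s) (false ∷ σ) τ (s≤s s≤σ) = ⊑ᵇ-++ s σ τ s≤σ

inGᵇ-++ : ∀ G σ τ → maxLen G ≤ length σ → inGᵇ G (σ ++ τ) ≡ inGᵇ G σ
inGᵇ-++ []      σ τ _   = refl
inGᵇ-++ (s ∷ G) σ τ G≤σ = cong₂ _∨_ (⊑ᵇ-++ s σ τ (≤-trans (m≤m⊔n (length s) (maxLen G)) G≤σ))
                                    (inGᵇ-++ G σ τ (≤-trans (m≤n⊔m (length s) (maxLen G)) G≤σ))

inGᵇ-dependsOnFirst : ∀ G → DependsOnFirst (maxLen G) (inGᵇ G)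
inGᵇ-dependsOnFirst G σ τ τ′ ∣σ∣≡ = trans (inGᵇ-++ G σ τ G≤σ) (sym (inGᵇ-++ G σ τ′ G≤σ))
  where G≤σ = ≤-reflexive (sym ∣σ∣≡)

μ⟦⟧∩⟦⟧≤μ⟦⟧ : ∀ G τ → μ⟦ G ⟧∩⟦ τ ⟧ ≤ᵈ μ⟦ G ⟧
μ⟦⟧∩⟦⟧≤μ⟦⟧ G τ = begin
  count L′ (λ ρ → inGᵇ G ρ ∧ (τ ⊑ᵇ ρ)) * 2 ^ L
    ≤⟨ *-monoˡ-≤ (2 ^ L) (length-filterᵇ-∧ (inGᵇ G) (τ ⊑ᵇ_) (allStr L′)) ⟩
  count L′ (inGᵇ G) * 2 ^ L            ≡⟨ cong (λ n → count n (inGᵇ G) * 2 ^ L) L+d≡L′ ⟨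
  count (L + d) (inGᵇ G) * 2 ^ L       ≡⟨ cong (_* 2 ^ L) (count-refine L (inGᵇ G) (inGᵇ-dependsOnFirst G) d) ⟩
  count L (inGᵇ G) * 2 ^ d * 2 ^ L     ≡⟨ *-assoc (count L (inGᵇ G)) (2 ^ d) (2 ^ L) ⟩
  count L (inGᵇ G) * (2 ^ d * 2 ^ L)   ≡⟨ cong (count L (inGᵇ G) *_) (^-distribˡ-+-* 2 d L) ⟨
  count L (inGᵇ G) * 2 ^ (d + L)       ≡⟨ cong (λ n → count L (inGᵇ G) * 2 ^ n) (trans (+-comm d L) L+d≡L′) ⟩
  count L (inGᵇ G) * 2 ^ L′            ∎
  where
  open ≤-Reasoning
  L  = maxLen G
  L′ = maxLen G ⊔ length τ
  d  = L′ ∸ L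
  L+d≡L′ : L + d ≡ L′
  L+d≡L′ = m+[n∸m]≡n (m≤m⊔n L (length τ))

≤ᵈ-trans : ∀ {x y z} → x ≤ᵈ y → y ≤ᵈ z → x ≤ᵈ z
≤ᵈ-trans {a /2^ e} {b /2^ f} {c /2^ h} a≤b b≤c = *-cancelʳ-≤ (a * 2 ^ h) (c * 2 ^ e) (2 ^ f) {{m^n≢0 2 f}} (begin
  a * 2 ^ h * 2 ^ f  ≡⟨ swap a (2 ^ h) (2 ^ f) ⟩
  a * 2 ^ f * 2 ^ h  ≤⟨ *-monoˡ-≤ (2 ^ h) a≤b ⟩
  b * 2 ^ e * 2 ^ h  ≡⟨ swap b (2 ^ e) (2 ^ h) ⟩
  b * 2 ^ h * 2 ^ e  ≤⟨ *-monoˡ-≤ (2 ^ e) b≤c ⟩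
  c * 2 ^ f * 2 ^ e  ≡⟨ swap c (2 ^ f) (2 ^ e) ⟩
  c * 2 ^ e * 2 ^ f  ∎)
  where
  open ≤-Reasoning
  swap : ∀ x y z → x * y * z ≡ x * z * y
  swap = solve-∀

1/2^-antitone : ∀ {m n} → m ≤ n → (1 /2^ n) ≤ᵈ (1 /2^ m)
1/2^-antitone m≤n = *-monoʳ-≤ 1 (^-monoʳ-≤ 2 m≤n)

-- Thinning a test

skips : (ℕ → ℕ) → ℕ → ℕ
skips f zero    = 0
skips f (suc n) = suc (f (skips f n) + skips f n)

skipsᴾ : ∀ {f} → IsPrimRec₁ f → IsPrimRec₁ (skips f)
skipsᴾ F = recᴾ zeroᴾ (comp₁ succᴾ (comp₂ addᴾ (comp₁ F (projᴾ zero)) (projᴾ zero))) _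
                (λ { [] → refl }) (λ { n [] → refl })

n≤skips : ∀ f n → n ≤ skips f n
n≤skips f zero    = z≤n
n≤skips f (suc n) = s≤s (≤-trans (n≤skips f n) (m≤n+m (skips f n) (f (skips f n))))

f[skips]<skips-suc : ∀ f n → f (skips f n) < skips f (suc n)
f[skips]<skips-suc f n = s≤s (m≤m+n (f (skips f n)) (skips f n))

module Thinning (g : PR 1) (test : IsPRTest g) where

  m : ℕ → ℕ
  m = skips ⟦ g ⟧

  thinᴾ : IsPrimRec₁ (⟦ g ⟧ ∘ m)
  thinᴾ = comp₁ gᴾ (skipsᴾ gᴾ)
    where
    gᴾ : IsPrimRec₁ ⟦ g ⟧
    gᴾ = record { code = g ; sound = λ { (n ∷ []) → refl } }

  thin : PR 1
  thin = code thinᴾ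

  ⟦thin⟧ : ∀ n → ⟦ thin ⟧ n ≡ ⟦ g ⟧ (m n)
  ⟦thin⟧ n = sound thinᴾ (n ∷ [])

  U-thin : ∀ n → U thin n ≡ U g (m n)
  U-thin n = cong decodeSet (⟦thin⟧ n)

  padded : PR 1
  padded = code (comp₁ padᴾ thinᴾ)

  ⟦padded⟧ : ∀ n → ⟦ padded ⟧ n ≡ pad (⟦ thin ⟧ n)
  ⟦padded⟧ n = trans (sound (comp₁ padᴾ thinᴾ) (n ∷ [])) (cong pad (sym (⟦thin⟧ n)))

  thin-isTest : IsPRTest thin
  thin-isTest n = subst (λ G → μ⟦ G ⟧ ≤ᵈ (1 /2^ n)) (sym (U-thin n))
    (≤ᵈ-trans {μ⟦ U g (m n) ⟧} {1 /2^ m n} {1 /2^ n} (test (m n)) (1/2^-antitone (n≤skips ⟦ g ⟧ n)))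

  μ⟦U-thin-suc⟧ : ∀ n → μ⟦ U thin (suc n) ⟧ ≤ᵈ (1 /2^ suc (⟦ thin ⟧ n))
  μ⟦U-thin-suc⟧ n = subst₂ (λ G c → μ⟦ G ⟧ ≤ᵈ (1 /2^ suc c)) (sym (U-thin (suc n))) (sym (⟦thin⟧ n))
    (≤ᵈ-trans {μ⟦ U g (m (suc n)) ⟧} {1 /2^ m (suc n)} {1 /2^ suc (⟦ g ⟧ (m n))}
              (test (m (suc n))) (1/2^-antitone (f[skips]<skips-suc ⟦ g ⟧ n)))

  HalvesNext : ℕ → Str → Set
  HalvesNext n τ = (length τ ≡ ⟦ thin ⟧ n) × ((μ⟦ U thin (suc n) ⟧∩⟦ τ ⟧) ≤ᵈ (1 /2^ suc (length τ)))

  halvesNext : ∀ n τ → length τ ≡ ⟦ thin ⟧ n → HalvesNext n τ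
  halvesNext n τ ∣τ∣≡ = ∣τ∣≡ ,
    ≤ᵈ-trans {μ⟦ U thin (suc n) ⟧∩⟦ τ ⟧} {μ⟦ U thin (suc n) ⟧} {1 /2^ suc (length τ)}
             (μ⟦⟧∩⟦⟧≤μ⟦⟧ (U thin (suc n)) τ)
             (subst (λ c → μ⟦ U thin (suc n) ⟧ ≤ᵈ (1 /2^ suc c)) (sym ∣τ∣≡) (μ⟦U-thin-suc⟧ n))

  thin-isWeak : IsWeakPRTest thin
  thin-isWeak = thin-isTest , padded , thin , λ n →
    (λ X → subst (λ y → (X ∈⟦ U thin n ⟧) ⇔ (X ∈⟦ decodeSet y ⟧)) (sym (⟦padded⟧ n))
                 (mk⇔ (⊆⟦pad⟧ (⟦ thin ⟧ n) X) (⟦pad⟧⊆ (⟦ thin ⟧ n) X))) ,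
    subst (λ y → All (HalvesNext n) (decodeSet y)) (sym (⟦padded⟧ n))
          (All.map (λ {τ} → halvesNext n τ) (All-length-pad (⟦ thin ⟧ n)))

proposition2p2 : (X : Seq) → MLBPRandom X ⇔ (∀ g → IsWeakPRTest g → Passes X g)
proposition2p2 X = mk⇔
  (λ random g weak → random g (proj₁ weak))
  (λ passesWeak g test X∈⋂U → let open Thinning g test in
     passesWeak thin thin-isWeak (λ n → subst (X ∈⟦_⟧) (sym (U-thin n)) (X∈⋂U (m n))))
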